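{- Let $k\geq 2$ be an integer and let $G$ be a finite connected simple graph with $n\geq 3$ vertices. Then $$\gamma_k(G)\leq \begin{cases}\frac{3k+1}{8}n & \text{if } k \text{ is odd},\\ \frac{3k}{8}n & \text{if } k \text{ is even};\end{cases}\qquad \gamma_k^s(G)\leq \begin{cases}\frac{3k+1}{8}n & \text{if } k \text{ is odd},\\ \frac{2k}{5}n & \text{if } k\in\{2,4,6\},\\ \frac{3k}{8}n & \text{if } k\geq 8 \text{ and } k \text{ is even}.\end{cases}$$
   Context: Let $G=(V,E)$ be a finite simple graph and $k$ a positive integer. For a vertex $u$, $N_G(u)$ is its open neighbourhood and $N_G[u]=N_G(u)\cup\{u\}$. For a function $f:V\to\{0,1,\dots,k\}$ its weight is $w(f)=\sum_{v\in V}f(v)$. The function $f$ is a Roman $k$-dominating function ($k$-RDF) if every $u\in V$ with $f(u)<k/2$ satisfies $\sum_{v\in N_G[u]}f(v)\geq k$. It is a strong Roman $k$-dominating function ($k$-SRDF) if every $u\in V$ with $f(u)<k/2$ satisfies $f(u)+\sum_{v\in N_G(u),\, f(v)>k/2}f(v)\geq k$. The Roman $k$-domination number $\gamma_k(G)$ is the minimum weight of a $k$-RDF of $G$, and the strong Roman $k$-domination number $\gamma_k^s(G)$ is the minimum weight of a $k$-SRDF of $G$. -}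

module Defs where

open import Data.Nat using (ℕ; zero; suc; _+_; _*_; _≤_; _<_; _<ᵇ_)
open import Data.Fin using (Fin; zero; suc)
open import Data.Bool using (Bool; true; false; if_then_else_)
open import Data.Product using (Σ; _×_; _,_)
open import Relation.Binary.PropositionalEquality using (_≡_)

sumFin : ∀ {n} → (Fin n → ℕ) → ℕ
sumFin {zero}  g = 0
sumFin {suc n} g = g zero + sumFin (λ i → g (suc i))

record Graph (n : ℕ) : Set where
  field
    adj      : Fin n → Fin n → Bool
    adj-sym  : ∀ u v → adj u v ≡ adj v u
    adj-irr  : ∀ u → adj u u ≡ false
open Graph public

data Walk {n : ℕ} (G : Graph n) : Fin n → Fin n → Set where
  here : ∀ u → Walk G u u
  step : ∀ {u v w} → adj G u v ≡ true → Walk G v w → Walk G u w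

Connected : ∀ {n} → Graph n → Set
Connected G = ∀ u v → Walk G u v

weight : ∀ {n} → (Fin n → ℕ) → ℕ
weight f = sumFin f

nbhdSum : ∀ {n} → Graph n → (Fin n → ℕ) → Fin n → ℕ
nbhdSum G f u = sumFin (λ v → if adj G u v then f v else 0)

-- Σ_{v ∈ N(u), f v > k/2} f v   (f v > k/2  ⇔  k < 2 f v)
strongNbhdSum : ∀ {n} → ℕ → Graph n → (Fin n → ℕ) → Fin n → ℕ
strongNbhdSum k G f u =
  sumFin (λ v → if adj G u v then (if k <ᵇ 2 * f v then f v else 0) else 0)

-- Roman k-dominating function (f u < k/2  ⇔  2 f u < k)
IsRkDF : ∀ {n} → ℕ → Graph n → (Fin n → ℕ) → Set
IsRkDF k G f = (∀ v → f v ≤ k) ×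
  (∀ u → 2 * f u < k → k ≤ f u + nbhdSum G f u)

IsSRkDF : ∀ {n} → ℕ → Graph n → (Fin n → ℕ) → Set
IsSRkDF k G f = (∀ v → f v ≤ k) ×
  (∀ u → 2 * f u < k → k ≤ f u + strongNbhdSum k G f u)

-- γ_k(G) ≤ a / d   (rational bound a/d with d > 0).
-- γ_k is the minimum weight of a k-RDF; since the graph is finite and
-- (f ≡ k) is always a k-RDF, the minimum is ≤ a/d iff some k-RDF f
-- has weight with d * w(f) ≤ a.
γ≤ : ∀ {n} → ℕ → Graph n → ℕ → ℕ → Set
γ≤ {n} k G a d = Σ (Fin n → ℕ) λ f → IsRkDF k G f × d * weight f ≤ a

γˢ≤ : ∀ {n} → ℕ → Graph n → ℕ → ℕ → Set
γˢ≤ {n} k G a d = Σ (Fin n → ℕ) λ f → IsSRkDF k G f × d * weight f ≤ a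

-- Fix a breadth-first spanning tree of G. Its vertex set splits into spiders with at least three
-- vertices, a spider being a centre with legs of length one or two along tree edges: repeatedly cut
-- off everything at most two levels below a suitable vertex near the bottom of the tree, and when
-- fewer than three vertices would remain, hang them on the last spider as one more leg. A spider
-- with p legs of length one and q legs of length two has 1 + p + 2q vertices, and one of three
-- labellings dominates it within the required weight per vertex: k on the centre and about k/2 on
-- the ends of the long legs; k on the middle vertex when the spider is a path on three vertices; or
-- about k/2 on every vertex except the middle vertices of long legs. The pointwise maximum of the
-- labellings of the spiders is a labelling of G of the required weight.

module Submission where

open import Defs
open import Data.Bool using (Bool; true; false; if_then_else_; _∧_; _∨_; not; T)
import Data.Bool.Properties as Bool
open import Data.Empty using (⊥; ⊥-elim)
open import Data.Fin using (Fin; zero; suc; _≟_)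
open import Data.Fin.Properties as Fin using (any?)
open import Data.List using (_∷_; []; allFin)
open import Data.List.Extrema.Nat using (argmax; f[xs]≤f[argmax])
open import Data.List.Membership.Propositional.Properties using (∈-allFin)
import Data.List.Relation.Unary.All as All
open import Data.Nat using (ℕ; zero; suc; _+_; _*_; _≤_; _<_; z≤n; s≤s; pred; _<ᵇ_; _⊔_; _≤?_; ≢-nonZero)
import Data.Nat as ℕ
open import Data.Nat.Induction using (<-rec)
open import Data.Nat.Properties hiding (_≟_)
open import Algebra.Properties.CommutativeSemigroup +-commutativeSemigroup using (interchange)
open import Data.Nat.Tactic.RingSolver using (solve; solve-∀)
open import Data.Product using (∃; ∃₂; _×_; _,_; proj₁; proj₂)
open import Data.Sum using (_⊎_; inj₁; inj₂)
open import Function using (_∘_)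
open import Relation.Nullary using (Dec; yes; no; does; ¬_; ¬?)
open import Relation.Nullary.Decidable using (_×-dec_; _⊎-dec_; dec-true; dec-false)
open import Relation.Binary.PropositionalEquality

-- Finite sums

sumFin-cong : ∀ {n} {f g : Fin n → ℕ} → (∀ i → f i ≡ g i) → sumFin f ≡ sumFin g
sumFin-cong {zero}  f≗g = refl
sumFin-cong {suc n} f≗g = cong₂ _+_ (f≗g zero) (sumFin-cong (f≗g ∘ suc))

sumFin-mono : ∀ {n} {f g : Fin n → ℕ} → (∀ i → f i ≤ g i) → sumFin f ≤ sumFin g
sumFin-mono {zero}  f≤g = z≤n
sumFin-mono {suc n} f≤g = +-mono-≤ (f≤g zero) (sumFin-mono (f≤g ∘ suc))

sumFin-+ : ∀ {n} (f g : Fin n → ℕ) → sumFin (λ i → f i + g i) ≡ sumFin f + sumFin g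
sumFin-+ {zero}  f g = refl
sumFin-+ {suc n} f g = trans (cong (f zero + g zero +_) (sumFin-+ (f ∘ suc) (g ∘ suc)))
                             (interchange (f zero) (g zero) _ _)

sumFin-*ˡ : ∀ {n} a (f : Fin n → ℕ) → sumFin (λ i → a * f i) ≡ a * sumFin f
sumFin-*ˡ {zero}  a f = sym (*-zeroʳ a)
sumFin-*ˡ {suc n} a f = trans (cong (a * f zero +_) (sumFin-*ˡ a (f ∘ suc)))
                              (sym (*-distribˡ-+ a (f zero) _))

sumFin-zero : ∀ {n} {f : Fin n → ℕ} → (∀ i → f i ≡ 0) → sumFin f ≡ 0
sumFin-zero {zero}  f≡0 = refl
sumFin-zero {suc n} f≡0 = cong₂ _+_ (f≡0 zero) (sumFin-zero (f≡0 ∘ suc))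

sumFin-single : ∀ {n} (f : Fin n → ℕ) j → (∀ i → i ≢ j → f i ≡ 0) → sumFin f ≡ f j
sumFin-single f zero    f≡0 =
  trans (cong (f zero +_) (sumFin-zero (λ i → f≡0 (suc i) λ ()))) (+-identityʳ (f zero))
sumFin-single f (suc j) f≡0 = cong₂ _+_ (f≡0 zero λ ())
  (sumFin-single (f ∘ suc) j (λ i i≢j → f≡0 (suc i) (i≢j ∘ Fin.suc-injective)))

term≤sumFin : ∀ {n} (f : Fin n → ℕ) i → f i ≤ sumFin f
term≤sumFin f zero    = m≤m+n (f zero) _
term≤sumFin f (suc i) = ≤-trans (term≤sumFin (f ∘ suc) i) (m≤n+m _ (f zero))

two-terms≤sumFin : ∀ {n} (f : Fin n → ℕ) {i j} → i ≢ j → f i + f j ≤ sumFin f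
two-terms≤sumFin f {zero}  {zero}  i≢j = ⊥-elim (i≢j refl)
two-terms≤sumFin f {zero}  {suc j} _   = +-monoʳ-≤ (f zero) (term≤sumFin (f ∘ suc) j)
two-terms≤sumFin f {suc i} {zero}  _   =
  ≤-trans (≤-reflexive (+-comm (f (suc i)) (f zero))) (+-monoʳ-≤ (f zero) (term≤sumFin (f ∘ suc) i))
two-terms≤sumFin f {suc i} {suc j} i≢j =
  ≤-trans (two-terms≤sumFin (f ∘ suc) (i≢j ∘ cong suc)) (m≤n+m _ (f zero))

-- Vertex sets

true≢false : true ≢ false
true≢false ()

dec-true⁻¹ : ∀ {p} {P : Set p} (P? : Dec P) → does P? ≡ true → P
dec-true⁻¹ (yes p) _ = p

dec-false⁻¹ : ∀ {p} {P : Set p} (P? : Dec P) → does P? ≡ false → ¬ P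
dec-false⁻¹ P? does≡false p = true≢false (trans (sym (dec-true P? p)) does≡false)

VertexSet : ℕ → Set
VertexSet n = Fin n → Bool

indicator : Bool → ℕ
indicator true  = 1
indicator false = 0

private
  variable
    n : ℕ

infix 4 _∈_ _∉_ _⊆_
infixl 6 _∖_

_∈_ _∉_ : Fin n → VertexSet n → Set
v ∈ S = S v ≡ true
v ∉ S = S v ≡ false

_⊆_ : VertexSet n → VertexSet n → Set
C ⊆ S = ∀ {v} → v ∈ C → v ∈ S

_∖_ : VertexSet n → VertexSet n → VertexSet n
(S ∖ C) v = S v ∧ not (C v)

full : VertexSet n
full _ = true

⁅_⁆ : Fin n → VertexSet n
⁅ x ⁆ v = does (v ≟ x)

∣_∣ : VertexSet n → ℕ
∣ S ∣ = sumFin (λ v → indicator (S v))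

∈-∖⁺ : ∀ {S C : VertexSet n} {v} → v ∈ S → v ∉ C → v ∈ S ∖ C
∈-∖⁺ v∈S v∉C rewrite v∈S | v∉C = refl

∈-∖⁻ : ∀ {S C : VertexSet n} {v} → v ∈ S ∖ C → v ∈ S × v ∉ C
∈-∖⁻ {S = S} {C} {v} v∈S∖C with S v | C v
... | true | false = refl , refl

∈-∖-or : ∀ {S : VertexSet n} C {v} → v ∈ S → v ∈ C ⊎ v ∈ S ∖ C
∈-∖-or C {v} v∈S with C v
... | true  = inj₁ refl
... | false rewrite v∈S = inj₂ refl

sumFin-if : ∀ (S : VertexSet n) x → sumFin (λ v → if S v then x else 0) ≡ x * ∣ S ∣
sumFin-if S x = trans (sumFin-cong pointwise) (sumFin-*ˡ x (indicator ∘ S))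
  where
  pointwise : ∀ v → (if S v then x else 0) ≡ x * indicator (S v)
  pointwise v with S v
  ... | true  = sym (*-identityʳ x)
  ... | false = sym (*-zeroʳ x)

∣∣-split : ∀ {S C : VertexSet n} → C ⊆ S → ∣ S ∣ ≡ ∣ C ∣ + ∣ S ∖ C ∣
∣∣-split {S = S} {C} C⊆S = trans (sumFin-cong pointwise) (sumFin-+ (indicator ∘ C) (indicator ∘ (S ∖ C)))
  where
  pointwise : ∀ v → indicator (S v) ≡ indicator (C v) + indicator ((S ∖ C) v)
  pointwise v with C v in v∈C
  ... | true rewrite C⊆S v∈C = refl
  ... | false rewrite Bool.∧-identityʳ (S v) = refl

∣⁅⁆∣ : ∀ (x : Fin n) → ∣ ⁅ x ⁆ ∣ ≡ 1
∣⁅⁆∣ x = trans (sumFin-single _ x (λ v v≢x → cong indicator (dec-false (v ≟ x) v≢x)))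
               (cong indicator (dec-true (x ≟ x) refl))

∣∣-remove : ∀ {S : VertexSet n} {x} → x ∈ S → ∣ S ∣ ≡ suc ∣ S ∖ ⁅ x ⁆ ∣
∣∣-remove {S = S} {x} x∈S =
  trans (∣∣-split {S = S} ⁅x⁆⊆S) (cong (_+ ∣ S ∖ ⁅ x ⁆ ∣) (∣⁅⁆∣ x))
  where
  ⁅x⁆⊆S : ⁅ x ⁆ ⊆ S
  ⁅x⁆⊆S {v} v∈⁅x⁆ = subst (_∈ S) (sym (dec-true⁻¹ (v ≟ x) v∈⁅x⁆)) x∈S

∈-remove⁺ : ∀ {S : VertexSet n} {x v} → v ∈ S → v ≢ x → v ∈ S ∖ ⁅ x ⁆
∈-remove⁺ {S = S} {x} {v} v∈S v≢x = ∈-∖⁺ {S = S} {⁅ x ⁆} v∈S (dec-false (v ≟ x) v≢x)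

∈-remove⁻ : ∀ {S : VertexSet n} {x v} → v ∈ S ∖ ⁅ x ⁆ → v ∈ S × v ≢ x
∈-remove⁻ {S = S} {x} {v} v∈S-x =
  let v∈S , v∉⁅x⁆ = ∈-∖⁻ {S = S} {⁅ x ⁆} v∈S-x in v∈S , dec-false⁻¹ (v ≟ x) v∉⁅x⁆

∣∣-witness : ∀ {S : VertexSet n} → 0 < ∣ S ∣ → ∃ (_∈ S)
∣∣-witness {n = suc n} {S} pos with S zero in S0
... | true  = zero , S0
... | false = let v , v∈S = ∣∣-witness {S = S ∘ suc} pos in suc v , v∈S

∣∣-≥1 : ∀ {S : VertexSet n} {x} → x ∈ S → 1 ≤ ∣ S ∣
∣∣-≥1 {S = S} x∈S = subst (1 ≤_) (sym (∣∣-remove {S = S} x∈S)) (s≤s z≤n)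

∣∣-≥2 : ∀ {S : VertexSet n} {x y} → x ∈ S → y ∈ S → x ≢ y → 2 ≤ ∣ S ∣
∣∣-≥2 {S = S} x∈S y∈S x≢y =
  subst (2 ≤_) (sym (∣∣-remove {S = S} x∈S))
        (s≤s (∣∣-≥1 {S = S ∖ ⁅ _ ⁆} (∈-remove⁺ {S = S} y∈S (x≢y ∘ sym))))

∣∣-≥3 : ∀ {S : VertexSet n} {x y z} → x ∈ S → y ∈ S → z ∈ S →
        x ≢ y → x ≢ z → y ≢ z → 3 ≤ ∣ S ∣
∣∣-≥3 {S = S} x∈S y∈S z∈S x≢y x≢z y≢z = subst (3 ≤_) (sym (∣∣-remove {S = S} x∈S))
  (s≤s (∣∣-≥2 (∈-remove⁺ {S = S} y∈S (x≢y ∘ sym)) (∈-remove⁺ {S = S} z∈S (x≢z ∘ sym)) y≢z))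

∣full∣ : ∣ full {n} ∣ ≡ n
∣full∣ {zero}  = refl
∣full∣ {suc n} = cong suc (∣full∣ {n})

private
  injection-≤ : ∀ m {X Y : VertexSet n} (φ : Fin n → Fin n) → ∣ X ∣ ≡ m →
                (∀ {x} → x ∈ X → φ x ∈ Y) → (∀ {x y} → x ∈ X → y ∈ X → φ x ≡ φ y → x ≡ y) →
                ∣ X ∣ ≤ ∣ Y ∣
  injection-≤ zero    φ ∣X∣≡0 _ _ = ≤-trans (≤-reflexive ∣X∣≡0) z≤n
  injection-≤ {n} (suc m) {X} {Y} φ ∣X∣≡1+m maps inj = begin
    ∣ X ∣                ≡⟨ ∣∣-remove {S = X} x∈X ⟩
    suc ∣ X ∖ ⁅ x ⁆ ∣     ≤⟨ s≤s (injection-≤ m φ ∣X-x∣≡m maps′ inj′) ⟩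
    suc ∣ Y ∖ ⁅ φ x ⁆ ∣   ≡⟨ ∣∣-remove {S = Y} (maps x∈X) ⟨
    ∣ Y ∣                ∎
    where
    open ≤-Reasoning
    x : Fin n
    x = proj₁ (∣∣-witness {S = X} (subst (0 <_) (sym ∣X∣≡1+m) (s≤s z≤n)))
    x∈X : x ∈ X
    x∈X = proj₂ (∣∣-witness {S = X} (subst (0 <_) (sym ∣X∣≡1+m) (s≤s z≤n)))
    ∣X-x∣≡m : ∣ X ∖ ⁅ x ⁆ ∣ ≡ m
    ∣X-x∣≡m = suc-injective (trans (sym (∣∣-remove {S = X} x∈X)) ∣X∣≡1+m)
    maps′ : ∀ {v} → v ∈ X ∖ ⁅ x ⁆ → φ v ∈ Y ∖ ⁅ φ x ⁆
    maps′ v∈X-x = let v∈X , v≢x = ∈-remove⁻ {S = X} v∈X-x in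
      ∈-remove⁺ {S = Y} (maps v∈X) (v≢x ∘ inj v∈X x∈X)
    inj′ : ∀ {v w} → v ∈ X ∖ ⁅ x ⁆ → w ∈ X ∖ ⁅ x ⁆ → φ v ≡ φ w → v ≡ w
    inj′ v∈X-x w∈X-x = inj (proj₁ (∈-remove⁻ {S = X} v∈X-x)) (proj₁ (∈-remove⁻ {S = X} w∈X-x))

∣∣-injection : ∀ {X Y : VertexSet n} (φ : Fin n → Fin n) → (∀ {x} → x ∈ X → φ x ∈ Y) →
               (∀ {x y} → x ∈ X → y ∈ X → φ x ≡ φ y → x ≡ y) → ∣ X ∣ ≤ ∣ Y ∣
∣∣-injection φ = injection-≤ _ φ refl

-- Breadth-first search

least : (ℕ → Bool) → ℕ → ℕ
least P zero    = 0
least P (suc b) = if P 0 then 0 else suc (least (P ∘ suc) b)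

least-≤ : ∀ (P : ℕ → Bool) b {e} → P e ≡ true → least P b ≤ e
least-≤ P zero    _ = z≤n
least-≤ P (suc b) {e} Pe with P 0 in P0
... | true = z≤n
least-≤ P (suc b) {zero}  Pe | false = ⊥-elim (true≢false (trans (sym Pe) P0))
least-≤ P (suc b) {suc e} Pe | false = s≤s (least-≤ (P ∘ suc) b Pe)

least-holds : ∀ (P : ℕ → Bool) b → P b ≡ true → P (least P b) ≡ true
least-holds P zero    Pb = Pb
least-holds P (suc b) Pb with P 0 in P0
... | true  = P0
... | false = least-holds (P ∘ suc) b Pb

module BFS {n} (G : Graph n) (r : Fin n) (conn : Connected G) where

  neighbourIn? : (S : VertexSet n) (v : Fin n) → Dec (∃ λ w → adj G w v ≡ true × w ∈ S)
  neighbourIn? S v = any? (λ w → (adj G w v Bool.≟ true) ×-dec (S w Bool.≟ true))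

  ball : ℕ → VertexSet n
  ball zero    v = does (v ≟ r)
  ball (suc d) v = ball d v ∨ does (neighbourIn? (ball d) v)

  ball-step : ∀ d {w v} → w ∈ ball d → adj G w v ≡ true → v ∈ ball (suc d)
  ball-step d {w} {v} w∈ w~v =
    trans (cong (ball d v ∨_) (dec-true (neighbourIn? (ball d) v) (w , w~v , w∈))) (Bool.∨-zeroʳ (ball d v))

  ball-frontier : ∀ d {v} → v ∈ ball (suc d) → v ∉ ball d → ∃ λ w → adj G w v ≡ true × w ∈ ball d
  ball-frontier d {v} v∈ v∉ with ball d v | neighbourIn? (ball d) v
  ... | false | yes neighbour = neighbour

  reachable : ∀ d {u w} → Walk G u w → u ∈ ball d → ∃ λ e → w ∈ ball e
  reachable d (here _)    u∈ = d , u∈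
  reachable d (step u~ W) u∈ = reachable (suc d) W (ball-step d u∈ u~)

  radius : Fin n → ℕ
  radius v = proj₁ (reachable 0 (conn r v) (dec-true (r ≟ r) refl))

  depth : Fin n → ℕ
  depth v = least (λ d → ball d v) (radius v)

  depth-ball : ∀ v → v ∈ ball (depth v)
  depth-ball v = least-holds (λ d → ball d v) (radius v) (proj₂ (reachable 0 (conn r v) (dec-true (r ≟ r) refl)))

  depth-least : ∀ {v} d → v ∈ ball d → depth v ≤ d
  depth-least {v} d = least-≤ (λ d → ball d v) (radius v)

  depth-root : depth r ≡ 0
  depth-root = n≤0⇒n≡0 (depth-least 0 (dec-true (r ≟ r) refl))

  depth≡0 : ∀ {v} → depth v ≡ 0 → v ≡ r
  depth≡0 {v} d≡0 = dec-true⁻¹ (v ≟ r) (subst (λ d → v ∈ ball d) d≡0 (depth-ball v))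

  previous-layer : ∀ {v} → v ≢ r → ∃ λ w → adj G w v ≡ true × w ∈ ball (pred (depth v))
  previous-layer {v} v≢r with depth v in dv
  ... | zero  = ⊥-elim (v≢r (depth≡0 dv))
  ... | suc e = ball-frontier e (subst (λ d → v ∈ ball d) dv (depth-ball v)) v∉
    where
    v∉ : v ∉ ball e
    v∉ with ball e v in v∈
    ... | false = refl
    ... | true  = ⊥-elim (1+n≰n (subst (_≤ e) dv (depth-least e v∈)))

  parent : Fin n → Fin n
  parent v with neighbourIn? (ball (pred (depth v))) v
  ... | yes (w , _) = w
  ... | no _        = v

  parent-root : parent r ≡ r
  parent-root with neighbourIn? (ball (pred (depth r))) r
  ... | no _             = refl
  ... | yes (w , w~r , w∈) =
    ⊥-elim (true≢false (trans (sym w~r) (subst (λ x → adj G x r ≡ false) (sym w≡r) (adj-irr G r))))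
    where
    w≡r : w ≡ r
    w≡r = dec-true⁻¹ (w ≟ r) (subst (λ d → w ∈ ball (pred d)) depth-root w∈)

  parent-adj×depth : ∀ {v} → v ≢ r → adj G v (parent v) ≡ true × depth v ≡ suc (depth (parent v))
  parent-adj×depth {v} v≢r with neighbourIn? (ball (pred (depth v))) v
  ... | no ∄w = ⊥-elim (∄w (previous-layer v≢r))
  ... | yes (w , w~v , w∈) = trans (adj-sym G v w) w~v , ≤-antisym
      (depth-least (suc (depth w)) (ball-step (depth w) (depth-ball w) w~v))
      (m≤pred[n]⇒suc[m]≤n {{≢-nonZero (v≢r ∘ depth≡0)}} (depth-least _ w∈))

  parent-adj : ∀ {v} → v ≢ r → adj G v (parent v) ≡ true
  parent-adj = proj₁ ∘ parent-adj×depth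

  depth-parent : ∀ {v} → v ≢ r → depth v ≡ suc (depth (parent v))
  depth-parent = proj₂ ∘ parent-adj×depth

  ≢r-of-parent : ∀ {v} → parent v ≢ r → v ≢ r
  ≢r-of-parent parent≢r refl = parent≢r parent-root

  depth-parent-< : ∀ {v} → v ≢ r → depth (parent v) < depth v
  depth-parent-< v≢r = ≤-reflexive (sym (depth-parent v≢r))

  depth-parent-≤ : ∀ v → depth (parent v) ≤ depth v
  depth-parent-≤ v with v ≟ r
  ... | yes refl = ≤-reflexive (cong depth parent-root)
  ... | no v≢r   = <⇒≤ (depth-parent-< v≢r)

  depth-<⇒≢ : ∀ {v w} → depth v < depth w → v ≢ w
  depth-<⇒≢ d<d refl = <-irrefl refl d<d

-- Roman labellings

data Mode : Set where
  roman strong : Mode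

-- What a neighbour labelled x adds towards dominating a vertex: in a strong Roman labelling only
-- neighbours labelled more than k/2 count.
contribution : Mode → ℕ → ℕ → ℕ
contribution roman  k x = x
contribution strong k x = if k <ᵇ 2 * x then x else 0

contribution-large : ∀ mode {k x} → k < 2 * x → contribution mode k x ≡ x
contribution-large roman  k<2x = refl
contribution-large strong {k} {x} k<2x with k <ᵇ 2 * x in k<ᵇ2x
... | true  = refl
... | false = ⊥-elim (subst T k<ᵇ2x (<⇒<ᵇ k<2x))

contribution-mono : ∀ mode k {x y} → x ≤ y → contribution mode k x ≤ contribution mode k y
contribution-mono roman  k x≤y = x≤y
contribution-mono strong k {x} {y} x≤y with k <ᵇ 2 * x in k<ᵇ2x
... | false = z≤n
... | true  = ≤-trans x≤y (≤-reflexive (sym (contribution-large strong k<2y)))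
  where
  k<2y : k < 2 * y
  k<2y = <-≤-trans (<ᵇ⇒< k (2 * x) (subst T (sym k<ᵇ2x) _)) (*-monoʳ-≤ 2 x≤y)

contribution≤ : ∀ mode k x → contribution mode k x ≤ x
contribution≤ roman  k x = ≤-refl
contribution≤ strong k x with k <ᵇ 2 * x
... | true  = ≤-refl
... | false = z≤n

if-mono : ∀ b {x y} → x ≤ y → (if b then x else 0) ≤ (if b then y else 0)
if-mono true  x≤y = x≤y
if-mono false x≤y = z≤n

module Labelling {n} (G : Graph n) (k : ℕ) (mode : Mode) where

  support : (Fin n → ℕ) → Fin n → ℕ
  support f u = sumFin (λ v → if adj G u v then contribution mode k (f v) else 0)

  support-mono : ∀ {f g} u → (∀ v → f v ≤ g v) → support f u ≤ support g u
  support-mono u f≤g = sumFin-mono (λ v → if-mono (adj G u v) (contribution-mono mode k (f≤g v)))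

  neighbour≤support : ∀ f {u v} → adj G u v ≡ true → contribution mode k (f v) ≤ support f u
  neighbour≤support f {u} {v} u~v = subst (_≤ support f u) (cong (λ b → if b then _ else 0) u~v)
    (term≤sumFin (λ w → if adj G u w then contribution mode k (f w) else 0) v)

  two-neighbours≤support : ∀ f {u v w} → adj G u v ≡ true → adj G u w ≡ true → v ≢ w →
                           contribution mode k (f v) + contribution mode k (f w) ≤ support f u
  two-neighbours≤support f {u} {v} {w} u~v u~w v≢w =
    subst (_≤ support f u) (cong₂ _+_ (cong (λ b → if b then _ else 0) u~v) (cong (λ b → if b then _ else 0) u~w))
      (two-terms≤sumFin (λ x → if adj G u x then contribution mode k (f x) else 0) v≢w)

  record CheapLabelling (a d : ℕ) (S : VertexSet n) : Set where
    field
      label      : Fin n → ℕ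
      bounded    : ∀ v → label v ≤ k
      dominating : ∀ {u} → u ∈ S → 2 * label u < k → k ≤ label u + support label u
      cheap      : d * weight label ≤ a * ∣ S ∣

  -- The pointwise maximum keeps every vertex dominated and weighs at most the sum of the two.
  cheap-∪ : ∀ {a d S C} → C ⊆ S → CheapLabelling a d C → CheapLabelling a d (S ∖ C) → CheapLabelling a d S
  cheap-∪ {a} {d} {S} {C} C⊆S L₁ L₂ = record
    { label      = label
    ; bounded    = λ v → ⊔-lub (bounded₁ v) (bounded₂ v)
    ; dominating = dominating
    ; cheap      = cheap
    }
    where
    open CheapLabelling L₁ renaming
      (label to label₁; bounded to bounded₁; dominating to dominating₁; cheap to cheap₁)
    open CheapLabelling L₂ renaming
      (label to label₂; bounded to bounded₂; dominating to dominating₂; cheap to cheap₂)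
    label : Fin n → ℕ
    label v = label₁ v ⊔ label₂ v

    dominated-by-part : ∀ {f u} → (∀ v → f v ≤ label v) → (2 * f u < k → k ≤ f u + support f u) →
                        2 * label u < k → k ≤ label u + support label u
    dominated-by-part {f} {u} f≤ dom 2l<k =
      ≤-trans (dom (≤-<-trans (*-monoʳ-≤ 2 (f≤ u)) 2l<k)) (+-mono-≤ (f≤ u) (support-mono u f≤))

    dominating : ∀ {u} → u ∈ S → 2 * label u < k → k ≤ label u + support label u
    dominating {u} u∈S with ∈-∖-or {S = S} C u∈S
    ... | inj₁ u∈C   = dominated-by-part (λ v → m≤m⊔n (label₁ v) _) (dominating₁ u∈C)
    ... | inj₂ u∈S∖C = dominated-by-part (λ v → m≤n⊔m _ (label₂ v)) (dominating₂ u∈S∖C)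

    cheap : d * weight label ≤ a * ∣ S ∣
    cheap = begin
      d * weight label                        ≤⟨ *-monoʳ-≤ d (sumFin-mono (λ v → m⊔n≤m+n (label₁ v) (label₂ v))) ⟩
      d * sumFin (λ v → label₁ v + label₂ v)  ≡⟨ cong (d *_) (sumFin-+ label₁ label₂) ⟩
      d * (weight label₁ + weight label₂)     ≡⟨ *-distribˡ-+ d (weight label₁) (weight label₂) ⟩
      d * weight label₁ + d * weight label₂   ≤⟨ +-mono-≤ cheap₁ cheap₂ ⟩
      a * ∣ C ∣ + a * ∣ S ∖ C ∣               ≡⟨ *-distribˡ-+ a ∣ C ∣ ∣ S ∖ C ∣ ⟨
      a * (∣ C ∣ + ∣ S ∖ C ∣)                 ≡⟨ cong (a *_) (∣∣-split {S = S} {C = C} C⊆S) ⟨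
      a * ∣ S ∣                               ∎
      where open ≤-Reasoning

module _ {n} {G : Graph n} {k a d : ℕ} where
  open Labelling G k

  strong⇒roman : ∀ {S} → CheapLabelling strong a d S → CheapLabelling roman a d S
  strong⇒roman L = record
    { label      = label
    ; bounded    = bounded
    ; dominating = λ u∈S 2l<k → ≤-trans (dominating u∈S 2l<k) (+-monoʳ-≤ (label _)
                     (sumFin-mono (λ v → if-mono (adj G _ v) (contribution≤ strong k (label v)))))
    ; cheap      = cheap
    }
    where open CheapLabelling strong L

-- Spiders

-- A centre with legs of length one or two: `up` steps towards the centre, and distinct legs of
-- length two have distinct middle vertices.
record Spider {n} (G : Graph n) (C : VertexSet n) : Set where
  field
    centre       : Fin n
    up           : Fin n → Fin n
    centre∈      : centre ∈ C
    up∈          : ∀ {v} → v ∈ C → v ≢ centre → up v ∈ C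
    up-adj       : ∀ {v} → v ∈ C → v ≢ centre → adj G v (up v) ≡ true
    up-up        : ∀ {v} → v ∈ C → v ≢ centre → up v ≢ centre → up (up v) ≡ centre
    up-injective : ∀ {b b′} → b ∈ C → b′ ∈ C → b ≢ centre → b′ ≢ centre →
                   up b ≢ centre → up b ≡ up b′ → b ≡ b′

-- The centre, the end of a leg of length one, the middle and the end of a leg of length two, and
-- vertices outside the spider.
data Role : Set where
  hub leaf knee foot absent : Role

_is_ : Role → Role → Bool
hub  is hub  = true
leaf is leaf = true
knee is knee = true
foot is foot = true
_    is _    = false

is⇒≡ : ∀ {ρ σ} → ρ is σ ≡ true → ρ ≡ σ
is⇒≡ {hub}  {hub}  _ = refl
is⇒≡ {leaf} {leaf} _ = refl
is⇒≡ {knee} {knee} _ = refl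
is⇒≡ {foot} {foot} _ = refl

byRole : (atHub atLeaf atKnee atFoot : ℕ) → Role → ℕ
byRole h l kn f hub    = h
byRole h l kn f leaf   = l
byRole h l kn f knee   = kn
byRole h l kn f foot   = f
byRole h l kn f absent = 0

byRole-split : ∀ h l kn f ρ → byRole h l kn f ρ ≡
  (if ρ is hub then h else 0) +
  ((if ρ is leaf then l else 0) + ((if ρ is knee then kn else 0) + (if ρ is foot then f else 0)))
byRole-split h l kn f hub    = sym (+-identityʳ h)
byRole-split h l kn f leaf   = sym (+-identityʳ l)
byRole-split h l kn f knee   = sym (+-identityʳ kn)
byRole-split h l kn f foot   = refl
byRole-split h l kn f absent = refl

-- Labels by role that dominate every vertex of a spider with q legs of length two; `cost p` is the
-- weight of the labelling when there are p legs of length one.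
record Scheme (k : ℕ) (mode : Mode) (q : ℕ) : Set where
  field
    atHub atLeaf atKnee atFoot : ℕ
    bounded        : ∀ ρ → byRole atHub atLeaf atKnee atFoot ρ ≤ k
    hub-dominated  : 2 * atHub < k → 1 ≤ q × k ≤ atHub + contribution mode k atKnee
    leaf-dominated : 2 * atLeaf < k → k ≤ atLeaf + contribution mode k atHub
    knee-dominated : 2 * atKnee < k → k ≤ atKnee + (contribution mode k atHub + contribution mode k atFoot)
    foot-dominated : 2 * atFoot < k → k ≤ atFoot + contribution mode k atKnee

  value : Role → ℕ
  value = byRole atHub atLeaf atKnee atFoot

  cost : ℕ → ℕ
  cost p = atHub + atLeaf * p + atKnee * q + atFoot * q

record Affordable (k : ℕ) (mode : Mode) (a d p q : ℕ) : Set where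
  constructor _within_
  field
    scheme : Scheme k mode q
    budget : d * Scheme.cost scheme p ≤ a * (1 + p + q + q)

module Anatomy {n} {G : Graph n} {C : VertexSet n} (sp : Spider G C) where
  open Spider sp

  IsFootOf : Fin n → Fin n → Set
  IsFootOf v b = b ∈ C × b ≢ centre × up b ≡ v

  footOf? : (v : Fin n) → Dec (∃ (IsFootOf v))
  footOf? v = any? (λ b → (C b Bool.≟ true) ×-dec ¬? (b ≟ centre) ×-dec (up b ≟ v))

  role : Fin n → Role
  role v = if C v then (if does (v ≟ centre) then hub
                        else if does (up v ≟ centre) then (if does (footOf? v) then knee else leaf)
                        else foot)
           else absent

  data View (v : Fin n) : Role → Set where
    hub    : v ≡ centre → View v hub
    leaf   : v ∈ C → v ≢ centre → up v ≡ centre → ¬ ∃ (IsFootOf v) → View v leaf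
    knee   : ∀ {b} → v ∈ C → v ≢ centre → up v ≡ centre → IsFootOf v b → View v knee
    foot   : v ∈ C → v ≢ centre → up v ≢ centre → View v foot
    absent : v ∉ C → View v absent

  view : ∀ v → View v (role v)
  view v with C v in v∈ | v ≟ centre | up v ≟ centre | footOf? v
  ... | false | _        | _        | _              = absent v∈
  ... | true  | yes v≡c  | _        | _              = hub v≡c
  ... | true  | no v≢c   | yes up≡c | yes (b , isf)  = knee v∈ v≢c up≡c isf
  ... | true  | no v≢c   | yes up≡c | no ∄foot       = leaf v∈ v≢c up≡c ∄foot
  ... | true  | no v≢c   | no up≢c  | _              = foot v∈ v≢c up≢c

  view-of : ∀ {v ρ} → role v ≡ ρ → View v ρ
  view-of {v} role≡ρ = subst (View v) role≡ρ (view v)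

  role-centre : role centre ≡ hub
  role-centre rewrite centre∈ | dec-true (centre ≟ centre) refl = refl

  foot-intro : ∀ {b} → b ∈ C → b ≢ centre → up b ≢ centre → role b ≡ foot
  foot-intro {b} b∈ b≢c up≢c with role b | view b
  ... | hub    | hub b≡c              = ⊥-elim (b≢c b≡c)
  ... | leaf   | leaf _ _ up≡c _      = ⊥-elim (up≢c up≡c)
  ... | knee   | knee _ _ up≡c _      = ⊥-elim (up≢c up≡c)
  ... | foot   | foot _ _ _           = refl
  ... | absent | absent b∉            = ⊥-elim (true≢false (trans (sym b∈) b∉))

  knee-intro : ∀ {v b} → v ∈ C → v ≢ centre → up v ≡ centre → IsFootOf v b → role v ≡ knee
  knee-intro {v} {b} v∈ v≢c up≡c isf with role v | view v
  ... | hub    | hub v≡c              = ⊥-elim (v≢c v≡c)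
  ... | leaf   | leaf _ _ _ ∄foot     = ⊥-elim (∄foot (b , isf))
  ... | knee   | knee _ _ _ _         = refl
  ... | foot   | foot _ _ up≢c        = ⊥-elim (up≢c up≡c)
  ... | absent | absent v∉            = ⊥-elim (true≢false (trans (sym v∈) v∉))

  footOf : Fin n → Fin n
  footOf v with footOf? v
  ... | yes (b , _) = b
  ... | no _        = v

  footOf-isFoot : ∀ {v b} → IsFootOf v b → IsFootOf v (footOf v)
  footOf-isFoot {v} {b} isf with footOf? v
  ... | yes (_ , isf′) = isf′
  ... | no ∄foot       = ⊥-elim (∄foot (b , isf))

  withRole : Role → VertexSet n
  withRole ρ v = role v is ρ

  # : Role → ℕ
  # ρ = ∣ withRole ρ ∣

  weight-byRole : ∀ h l kn f →
                  weight (byRole h l kn f ∘ role) ≡ h * # hub + (l * # leaf + (kn * # knee + f * # foot))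
  weight-byRole h l kn f = begin
    sumFin (byRole h l kn f ∘ role)
      ≡⟨ sumFin-cong (byRole-split h l kn f ∘ role) ⟩
    sumFin (λ v → part hub h v + (part leaf l v + (part knee kn v + part foot f v)))
      ≡⟨ sumFin-+ (part hub h) _ ⟩
    sumFin (part hub h) + sumFin (λ v → part leaf l v + (part knee kn v + part foot f v))
      ≡⟨ cong (sumFin (part hub h) +_) (sumFin-+ (part leaf l) _) ⟩
    sumFin (part hub h) + (sumFin (part leaf l) + sumFin (λ v → part knee kn v + part foot f v))
      ≡⟨ cong (λ x → sumFin (part hub h) + (sumFin (part leaf l) + x)) (sumFin-+ (part knee kn) (part foot f)) ⟩
    sumFin (part hub h) + (sumFin (part leaf l) + (sumFin (part knee kn) + sumFin (part foot f)))
      ≡⟨ cong₂ _+_ (sumFin-if (withRole hub) h)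
           (cong₂ _+_ (sumFin-if (withRole leaf) l)
             (cong₂ _+_ (sumFin-if (withRole knee) kn) (sumFin-if (withRole foot) f))) ⟩
    h * # hub + (l * # leaf + (kn * # knee + f * # foot)) ∎
    where
    open ≡-Reasoning
    part : Role → ℕ → Fin n → ℕ
    part ρ x v = if withRole ρ v then x else 0

  #hub≡1 : # hub ≡ 1
  #hub≡1 = trans (sumFin-single (indicator ∘ withRole hub) centre not-hub)
                 (cong (λ ρ → indicator (ρ is hub)) role-centre)
    where
    not-hub : ∀ v → v ≢ centre → indicator (role v is hub) ≡ 0
    not-hub v v≢c with role v | view v
    ... | hub    | hub v≡c = ⊥-elim (v≢c v≡c)
    ... | leaf   | _       = refl
    ... | knee   | _       = refl
    ... | foot   | _       = refl
    ... | absent | _       = refl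

  #knee≡#foot : # knee ≡ # foot
  #knee≡#foot = ≤-antisym (∣∣-injection footOf knee→foot footOf-injective)
                          (∣∣-injection up foot→knee up-injective-on-feet)
    where
    knee→foot : ∀ {v} → v ∈ withRole knee → footOf v ∈ withRole foot
    knee→foot {v} v∈K with view-of (is⇒≡ v∈K)
    ... | knee _ v≢c _ isf = let b∈ , b≢c , up≡v = footOf-isFoot isf in
      cong (_is foot) (foot-intro b∈ b≢c (λ up≡c → v≢c (trans (sym up≡v) up≡c)))
    footOf-injective : ∀ {v w} → v ∈ withRole knee → w ∈ withRole knee → footOf v ≡ footOf w → v ≡ w
    footOf-injective v∈K w∈K eq with view-of (is⇒≡ v∈K) | view-of (is⇒≡ w∈K)
    ... | knee _ _ _ isfv | knee _ _ _ isfw =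
      trans (sym (proj₂ (proj₂ (footOf-isFoot isfv)))) (trans (cong up eq) (proj₂ (proj₂ (footOf-isFoot isfw))))
    foot→knee : ∀ {b} → b ∈ withRole foot → up b ∈ withRole knee
    foot→knee {b} b∈F with view-of (is⇒≡ b∈F)
    ... | foot b∈ b≢c up≢c =
      cong (_is knee) (knee-intro (up∈ b∈ b≢c) up≢c (up-up b∈ b≢c up≢c) (b∈ , b≢c , refl))
    up-injective-on-feet : ∀ {b b′} → b ∈ withRole foot → b′ ∈ withRole foot → up b ≡ up b′ → b ≡ b′
    up-injective-on-feet b∈F b′∈F eq with view-of (is⇒≡ b∈F) | view-of (is⇒≡ b′∈F)
    ... | foot b∈ b≢c up≢c | foot b′∈ b′≢c _ = up-injective b∈ b′∈ b≢c b′≢c up≢c eq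

  ∣C∣≡#roles : ∣ C ∣ ≡ 1 * # hub + (1 * # leaf + (1 * # knee + 1 * # foot))
  ∣C∣≡#roles = trans (sumFin-cong pointwise) (weight-byRole 1 1 1 1)
    where
    pointwise : ∀ v → indicator (C v) ≡ byRole 1 1 1 1 (role v)
    pointwise v with role v | view v
    ... | hub    | hub refl       = cong indicator centre∈
    ... | leaf   | leaf v∈ _ _ _  = cong indicator v∈
    ... | knee   | knee v∈ _ _ _  = cong indicator v∈
    ... | foot   | foot v∈ _ _    = cong indicator v∈
    ... | absent | absent v∉      = cong indicator v∉

  ∣C∣≡legs : ∣ C ∣ ≡ 1 + # leaf + # foot + # foot
  ∣C∣≡legs rewrite ∣C∣≡#roles | #hub≡1 | #knee≡#foot = normalise (# leaf) (# foot)
    where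
    normalise : ∀ p q → 1 * 1 + (1 * p + (1 * q + 1 * q)) ≡ 1 + p + q + q
    normalise = solve-∀

module SpiderLabelling {n} (G : Graph n) (k : ℕ) (mode : Mode) {C : VertexSet n} (sp : Spider G C) where
  open Spider sp
  open Anatomy sp
  open Labelling G k mode

  affordable⇒cheap : ∀ {a d} → Affordable k mode a d (# leaf) (# foot) → CheapLabelling a d C
  affordable⇒cheap {a} {d} (s within budget) = record
    { label      = label
    ; bounded    = bounded ∘ role
    ; dominating = dominating
    ; cheap      = cheap
    }
    where
    open Scheme s
    label : Fin n → ℕ
    label = value ∘ role

    neighbour : ∀ {u w ρ} → adj G u w ≡ true → role w ≡ ρ → contribution mode k (value ρ) ≤ support label u
    neighbour {u} u~w role≡ρ = subst (λ x → contribution mode k x ≤ support label u) (cong value role≡ρ)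
                                     (neighbour≤support label u~w)

    towards-centre : ∀ {u} → u ∈ C → u ≢ centre → up u ≡ centre → adj G u centre ≡ true
    towards-centre {u} u∈ u≢c up≡c = subst (λ w → adj G u w ≡ true) up≡c (up-adj u∈ u≢c)

    from-foot : ∀ {v b} → IsFootOf v b → adj G v b ≡ true
    from-foot {v} {b} (b∈ , b≢c , up≡v) =
      trans (adj-sym G v b) (subst (λ w → adj G b w ≡ true) up≡v (up-adj b∈ b≢c))

    neighbours : ∀ {u w w′ ρ σ} → adj G u w ≡ true → adj G u w′ ≡ true → w ≢ w′ → role w ≡ ρ → role w′ ≡ σ →
                 contribution mode k (value ρ) + contribution mode k (value σ) ≤ support label u
    neighbours {u} u~w u~w′ w≢w′ role≡ρ role≡σ =
      subst₂ (λ x y → contribution mode k x + contribution mode k y ≤ support label u)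
             (cong value role≡ρ) (cong value role≡σ) (two-neighbours≤support label u~w u~w′ w≢w′)

    centre-dominated : 2 * atHub < k → k ≤ atHub + support label centre
    centre-dominated 2h<k with hub-dominated 2h<k
    ... | 1≤q , enough with ∣∣-witness {S = withRole foot} 1≤q
    ... | b , b∈F with view-of (is⇒≡ b∈F)
    ... | foot b∈ b≢c up≢c =
      ≤-trans enough (+-monoʳ-≤ atHub (neighbour (trans (adj-sym G centre (up b)) up~centre) up-knee))
      where
      up~centre : adj G (up b) centre ≡ true
      up~centre = towards-centre (up∈ b∈ b≢c) up≢c (up-up b∈ b≢c up≢c)
      up-knee : role (up b) ≡ knee
      up-knee = knee-intro (up∈ b∈ b≢c) up≢c (up-up b∈ b≢c up≢c) (b∈ , b≢c , refl)

    dominating : ∀ {u} → u ∈ C → 2 * label u < k → k ≤ label u + support label u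
    dominating {u} u∈C 2l<k with role u | view u
    ... | hub | hub refl = centre-dominated 2l<k
    ... | leaf | leaf u∈ u≢c up≡c _ =
      ≤-trans (leaf-dominated 2l<k) (+-monoʳ-≤ atLeaf (neighbour (towards-centre u∈ u≢c up≡c) role-centre))
    ... | knee | knee {b} u∈ u≢c up≡c isf@(b∈ , b≢c , up≡u) =
      ≤-trans (knee-dominated 2l<k) (+-monoʳ-≤ atKnee
        (neighbours (towards-centre u∈ u≢c up≡c) (from-foot isf) (b≢c ∘ sym) role-centre b-foot))
      where
      b-foot : role b ≡ foot
      b-foot = foot-intro b∈ b≢c (λ up≡c → u≢c (trans (sym up≡u) up≡c))
    ... | foot | foot u∈ u≢c up≢c =
      ≤-trans (foot-dominated 2l<k)
        (+-monoʳ-≤ atFoot (neighbour (up-adj u∈ u≢c)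
          (knee-intro (up∈ u∈ u≢c) up≢c (up-up u∈ u≢c up≢c) (u∈ , u≢c , refl))))
    ... | absent | absent u∉ = ⊥-elim (true≢false (trans (sym u∈C) u∉))

    weight≡cost : weight label ≡ cost (# leaf)
    weight≡cost = begin
      weight label
        ≡⟨ weight-byRole atHub atLeaf atKnee atFoot ⟩
      atHub * # hub + (atLeaf * # leaf + (atKnee * # knee + atFoot * # foot))
        ≡⟨ cong₂ (λ x y → atHub * x + (atLeaf * # leaf + (atKnee * y + atFoot * # foot))) #hub≡1 #knee≡#foot ⟩
      atHub * 1 + (atLeaf * # leaf + (atKnee * # foot + atFoot * # foot))
        ≡⟨ normalise atHub atLeaf atKnee atFoot (# leaf) (# foot) ⟩
      cost (# leaf) ∎
      where
      open ≡-Reasoning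
      normalise : ∀ h l kn f p q → h * 1 + (l * p + (kn * q + f * q)) ≡ h + l * p + kn * q + f * q
      normalise = solve-∀

    cheap : d * weight label ≤ a * ∣ C ∣
    cheap = begin
      d * weight label                      ≡⟨ cong (d *_) weight≡cost ⟩
      d * cost (# leaf)                     ≤⟨ budget ⟩
      a * (1 + # leaf + # foot + # foot)    ≡⟨ cong (a *_) ∣C∣≡legs ⟨
      a * ∣ C ∣                             ∎
      where open ≤-Reasoning

-- Three labelling schemes

≤-by-slack : ∀ {x y} s → x + s ≡ y → x ≤ y
≤-by-slack {x} s refl = m≤m+n x s

not-below-half : ∀ {A : Set} {k} x → k ≤ 2 * x → 2 * x < k → A
not-below-half x k≤2x 2x<k = ⊥-elim (<⇒≱ 2x<k k≤2x)

contribution-self : ∀ mode {k} → 1 ≤ k → contribution mode k k ≡ k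
contribution-self mode {k} 1≤k = contribution-large mode (m<m+n k (≤-trans 1≤k (≤-reflexive (sym (+-identityʳ k)))))

hubScheme : ∀ {k mode q} h → 1 ≤ k → k ≤ 2 * h → h ≤ k → Scheme k mode q
hubScheme {k} {mode} h 1≤k k≤2h h≤k = record
  { atHub = k ; atLeaf = 0 ; atKnee = 0 ; atFoot = h
  ; bounded        = λ { hub → ≤-refl ; leaf → z≤n ; knee → z≤n ; foot → h≤k ; absent → z≤n }
  ; hub-dominated  = not-below-half k (m≤n*m k 2)
  ; leaf-dominated = λ _ → ≤-reflexive (sym (contribution-self mode 1≤k))
  ; knee-dominated = λ _ → ≤-trans (≤-reflexive (sym (contribution-self mode 1≤k))) (m≤m+n _ _)
  ; foot-dominated = not-below-half h k≤2h
  }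

pathScheme : ∀ {k mode q} → 1 ≤ q → Scheme k mode q
pathScheme {k} {mode} 1≤q = record
  { atHub = 0 ; atLeaf = k ; atKnee = k ; atFoot = 0
  ; bounded        = λ { hub → z≤n ; leaf → ≤-refl ; knee → ≤-refl ; foot → z≤n ; absent → z≤n }
  ; hub-dominated  = λ 0<k → 1≤q , ≤-reflexive (sym (contribution-self mode 0<k))
  ; leaf-dominated = not-below-half k (m≤n*m k 2)
  ; knee-dominated = not-below-half k (m≤n*m k 2)
  ; foot-dominated = λ 0<k → ≤-reflexive (sym (contribution-self mode 0<k))
  }

halvesScheme : ∀ {k mode q} h → k ≤ 2 * h → h ≤ k → contribution mode k h ≡ h → Scheme k mode q
halvesScheme {k} {mode} h k≤2h h≤k contribution≡h = record
  { atHub = h ; atLeaf = h ; atKnee = 0 ; atFoot = h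
  ; bounded        = λ { hub → h≤k ; leaf → h≤k ; knee → z≤n ; foot → h≤k ; absent → z≤n }
  ; hub-dominated  = not-below-half h k≤2h
  ; leaf-dominated = not-below-half h k≤2h
  ; knee-dominated = λ _ → subst (k ≤_) (cong₂ _+_ (sym contribution≡h) (sym contribution≡h)) k≤h+h
  ; foot-dominated = not-below-half h k≤2h
  }
  where
  k≤h+h : k ≤ h + h
  k≤h+h = subst (k ≤_) (cong (h +_) (+-identityʳ h)) k≤2h

hub-affordable : ∀ {k mode a d p q} h → 1 ≤ k → k ≤ 2 * h → h ≤ k →
                 d * (k + h * q) ≤ a * (1 + p + q + q) → Affordable k mode a d p q
hub-affordable {k} {a = a} {d = d} {p} {q} h 1≤k k≤2h h≤k affordable =
  hubScheme h 1≤k k≤2h h≤k within subst (λ x → d * x ≤ a * (1 + p + q + q)) (sym (cost≡ k h p q)) affordable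
  where
  cost≡ : ∀ k h p q → k + 0 * p + 0 * q + h * q ≡ k + h * q
  cost≡ = solve-∀

path-affordable : ∀ {k mode a d p q} → 1 ≤ q →
                  d * (k * p + k * q) ≤ a * (1 + p + q + q) → Affordable k mode a d p q
path-affordable {k} {a = a} {d = d} {p} {q} 1≤q affordable =
  pathScheme 1≤q within subst (λ x → d * x ≤ a * (1 + p + q + q)) (sym (cost≡ k p q)) affordable
  where
  cost≡ : ∀ k p q → 0 + k * p + k * q + 0 * q ≡ k * p + k * q
  cost≡ = solve-∀

halves-affordable : ∀ {k mode a d p q} h → k ≤ 2 * h → h ≤ k → contribution mode k h ≡ h →
                    d * (h * (1 + p + q)) ≤ a * (1 + p + q + q) → Affordable k mode a d p q
halves-affordable {k} {a = a} {d = d} {p} {q} h k≤2h h≤k contribution≡h affordable =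
  halvesScheme h k≤2h h≤k contribution≡h within
    subst (λ x → d * x ≤ a * (1 + p + q + q)) (sym (cost≡ h p q)) affordable
  where
  cost≡ : ∀ h p q → h + h * p + 0 * q + h * q ≡ h * (1 + p + q)
  cost≡ = solve-∀

affordable-by-cases : ∀ {k mode a d} →
  (∀ p q → Affordable k mode a d (2 + p) q) → (∀ q → Affordable k mode a d 1 (1 + q)) →
  Affordable k mode a d 0 1 → (∀ q → Affordable k mode a d 0 (2 + q)) →
  ∀ p q → 3 ≤ 1 + p + q + q → Affordable k mode a d p q
affordable-by-cases many-leaves one-leaf path no-leaves (suc (suc p)) q             _ = many-leaves p q
affordable-by-cases many-leaves one-leaf path no-leaves 1             (suc q)       _ = one-leaf q
affordable-by-cases many-leaves one-leaf path no-leaves 0             1             _ = path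
affordable-by-cases many-leaves one-leaf path no-leaves 0             (suc (suc q)) _ = no-leaves q
affordable-by-cases many-leaves one-leaf path no-leaves 0             0             (s≤s ())
affordable-by-cases many-leaves one-leaf path no-leaves 1             0             (s≤s (s≤s ()))

roman-even-affordable : ∀ m → 1 ≤ m → ∀ p q → 3 ≤ 1 + p + q + q →
                        Affordable (2 * m) roman (3 * (2 * m)) 8 p q
roman-even-affordable m 1≤m = affordable-by-cases
  (λ p q → hub-affordable m 1≤2m ≤-refl (m≤n*m m 2)
             (≤-by-slack (2 * m + 6 * m * p + 4 * m * q) (solve (m ∷ p ∷ q ∷ []))))
  (λ q → hub-affordable m 1≤2m ≤-refl (m≤n*m m 2) (≤-by-slack (4 * m * q) (solve (m ∷ q ∷ []))))
  (halves-affordable m ≤-refl (m≤n*m m 2) refl (≤-by-slack (2 * m) (solve (m ∷ []))))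
  (λ q → halves-affordable m ≤-refl (m≤n*m m 2) refl (≤-by-slack (6 * m + 4 * m * q) (solve (m ∷ q ∷ []))))
  where
  1≤2m : 1 ≤ 2 * m
  1≤2m = ≤-trans 1≤m (m≤n*m m 2)

strong-odd-affordable : ∀ m p q → 3 ≤ 1 + p + q + q →
                        Affordable (2 * (1 + m) + 1) strong (3 * (2 * (1 + m) + 1) + 1) 8 p q
strong-odd-affordable m = affordable-by-cases
  (λ p q → hub-affordable (2 + m) (s≤s z≤n) (<⇒≤ k<2h) h≤k
             (≤-by-slack (6 + 2 * m + (10 + 6 * m) * p + 4 * (1 + m) * q) (solve (m ∷ p ∷ q ∷ []))))
  (λ q → hub-affordable (2 + m) (s≤s z≤n) (<⇒≤ k<2h) h≤k
           (≤-by-slack (4 * (1 + m) * q) (solve (m ∷ q ∷ []))))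
  (path-affordable ≤-refl (≤-by-slack (6 + 2 * m) (solve (m ∷ []))))
  (λ q → halves-affordable (2 + m) (<⇒≤ k<2h) h≤k (contribution-large strong k<2h)
           (≤-by-slack (2 + 6 * m + 4 * (1 + m) * q) (solve (m ∷ q ∷ []))))
  where
  k<2h : 2 * (1 + m) + 1 < 2 * (2 + m)
  k<2h = ≤-reflexive (solve (m ∷ []))
  h≤k : 2 + m ≤ 2 * (1 + m) + 1
  h≤k = ≤-by-slack (1 + m) (solve (m ∷ []))

strong-even-affordable : ∀ m → 1 ≤ m → ∀ p q → 3 ≤ 1 + p + q + q →
                         Affordable (2 * m) strong (2 * (2 * m)) 5 p q
strong-even-affordable m 1≤m = affordable-by-cases
  (λ p q → hub-affordable m 1≤2m ≤-refl (m≤n*m m 2)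
             (≤-by-slack (2 * m + 4 * m * p + 3 * m * q) (solve (m ∷ p ∷ q ∷ []))))
  (λ q → hub-affordable m 1≤2m ≤-refl (m≤n*m m 2) (≤-by-slack (m + 3 * m * q) (solve (m ∷ q ∷ []))))
  (path-affordable ≤-refl (≤-by-slack (2 * m) (solve (m ∷ []))))
  (λ q → hub-affordable m 1≤2m ≤-refl (m≤n*m m 2) (≤-by-slack (3 * m * q) (solve (m ∷ q ∷ []))))
  where
  1≤2m : 1 ≤ 2 * m
  1≤2m = ≤-trans 1≤m (m≤n*m m 2)

strong-even≥8-affordable : ∀ m p q → 3 ≤ 1 + p + q + q → Affordable (2 * (4 + m)) strong (3 * (2 * (4 + m))) 8 p q
strong-even≥8-affordable m = affordable-by-cases
  (λ p q → hub-affordable (4 + m) (s≤s z≤n) ≤-refl (m≤n*m (4 + m) 2)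
             (≤-by-slack (2 * (4 + m) + 6 * (4 + m) * p + 4 * (4 + m) * q) (solve (m ∷ p ∷ q ∷ []))))
  (λ q → hub-affordable (4 + m) (s≤s z≤n) ≤-refl (m≤n*m (4 + m) 2)
           (≤-by-slack (4 * (4 + m) * q) (solve (m ∷ q ∷ []))))
  (path-affordable ≤-refl (≤-by-slack (2 * (4 + m)) (solve (m ∷ []))))
  (λ q → halves-affordable (5 + m) (<⇒≤ k<2h) h≤k (contribution-large strong k<2h)
           (≤-by-slack (6 * m + 8 * q + 4 * m * q) (solve (m ∷ q ∷ []))))
  where
  k<2h : 2 * (4 + m) < 2 * (5 + m)
  k<2h = ≤-by-slack 1 (solve (m ∷ []))
  h≤k : 5 + m ≤ 2 * (4 + m)
  h≤k = ≤-by-slack (3 + m) (solve (m ∷ []))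

-- Cutting a breadth-first search tree into spiders

module SpiderDecomposition {n} (G : Graph n) (r : Fin n) (conn : Connected G) where
  open BFS G r conn

  record Closed (S : VertexSet n) : Set where
    field
      root∈   : r ∈ S
      parent∈ : ∀ {v} → v ∈ S → v ≢ r → parent v ∈ S

  Within₂ : Fin n → Fin n → Set
  Within₂ x v = v ≡ x ⊎ parent v ≡ x ⊎ parent (parent v) ≡ x

  within₂? : ∀ x v → Dec (Within₂ x v)
  within₂? x v = (v ≟ x) ⊎-dec (parent v ≟ x) ⊎-dec (parent (parent v) ≟ x)

  subtree₂ : VertexSet n → Fin n → VertexSet n
  subtree₂ S x v = S v ∧ does (within₂? x v)

  within₂-root : ∀ {x} → Within₂ x r → x ≡ r
  within₂-root (inj₁ r≡x)          = sym r≡x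
  within₂-root (inj₂ (inj₁ pr≡x))  = trans (sym pr≡x) parent-root
  within₂-root (inj₂ (inj₂ ppr≡x)) = trans (sym ppr≡x) (trans (cong parent parent-root) parent-root)

  depth-grandchild : ∀ {v} → parent v ≢ r → depth v ≡ 2 + depth (parent (parent v))
  depth-grandchild {v} pv≢r = trans (depth-parent (≢r-of-parent pv≢r)) (cong suc (depth-parent pv≢r))

  NoGrandTwins : VertexSet n → Fin n → Set
  NoGrandTwins S x =
    ∀ {b b′} → b ∈ S → b′ ∈ S → b ≢ b′ → parent b ≡ parent b′ → parent (parent b) ≡ x → ⊥

  module Subtree₂ (S : VertexSet n) (x : Fin n) where

    ∈⁺ : ∀ {v} → v ∈ S → Within₂ x v → v ∈ subtree₂ S x
    ∈⁺ {v} v∈S near rewrite v∈S = dec-true (within₂? x v) near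

    ∈⁻ : ∀ {v} → v ∈ subtree₂ S x → v ∈ S × Within₂ x v
    ∈⁻ {v} v∈ = Bool.∧-conicalˡ (S v) _ v∈ , dec-true⁻¹ (within₂? x v) (Bool.∧-conicalʳ (S v) _ v∈)

    ∌ : ∀ {v} → ¬ Within₂ x v → v ∉ subtree₂ S x
    ∌ {v} ¬near rewrite dec-false (within₂? x v) ¬near = Bool.∧-zeroʳ (S v)

    spider : Closed S → x ∈ S → x ≢ r → NoGrandTwins S x → Spider G (subtree₂ S x)
    spider closed x∈S x≢r no-twins = record
      { centre       = x
      ; up           = parent
      ; centre∈      = ∈⁺ x∈S (inj₁ refl)
      ; up∈          = up∈
      ; up-adj       = λ v∈ _ → parent-adj (≢r v∈)
      ; up-up        = up-up
      ; up-injective = up-injective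
      }
      where
      open Closed closed
      ≢r : ∀ {v} → v ∈ subtree₂ S x → v ≢ r
      ≢r v∈ refl = x≢r (within₂-root (proj₂ (∈⁻ v∈)))

      up∈ : ∀ {v} → v ∈ subtree₂ S x → v ≢ x → parent v ∈ subtree₂ S x
      up∈ v∈ v≢x with ∈⁻ v∈
      ... | _   , inj₁ v≡x          = ⊥-elim (v≢x v≡x)
      ... | v∈S , inj₂ (inj₁ pv≡x)  = ∈⁺ (parent∈ v∈S (≢r v∈)) (inj₁ pv≡x)
      ... | v∈S , inj₂ (inj₂ ppv≡x) = ∈⁺ (parent∈ v∈S (≢r v∈)) (inj₂ (inj₁ ppv≡x))

      up-up : ∀ {v} → v ∈ subtree₂ S x → v ≢ x → parent v ≢ x → parent (parent v) ≡ x
      up-up v∈ v≢x pv≢x with proj₂ (∈⁻ v∈)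
      ... | inj₁ v≡x          = ⊥-elim (v≢x v≡x)
      ... | inj₂ (inj₁ pv≡x)  = ⊥-elim (pv≢x pv≡x)
      ... | inj₂ (inj₂ ppv≡x) = ppv≡x

      up-injective : ∀ {b b′} → b ∈ subtree₂ S x → b′ ∈ subtree₂ S x → b ≢ x → b′ ≢ x →
                     parent b ≢ x → parent b ≡ parent b′ → b ≡ b′
      up-injective {b} {b′} b∈ b′∈ b≢x _ pb≢x pb≡pb′ with b ≟ b′
      ... | yes b≡b′ = b≡b′
      ... | no b≢b′  =
        ⊥-elim (no-twins (proj₁ (∈⁻ b∈)) (proj₁ (∈⁻ b′∈)) b≢b′ pb≡pb′ (up-up b∈ b≢x pb≢x))

    rest : Closed S → x ∈ S → x ≢ r → (∀ {v} → v ∈ S → depth v ≤ 2 + depth x) →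
                    Closed (S ∖ subtree₂ S x) × parent x ∈ S ∖ subtree₂ S x
    rest closed x∈S x≢r shallow =
      record { root∈ = rest⁺ root∈ (x≢r ∘ within₂-root) ; parent∈ = rest-parent∈ } ,
      rest⁺ (parent∈ x∈S x≢r) parent-outside
      where
      open Closed closed
      rest⁺ : ∀ {v} → v ∈ S → ¬ Within₂ x v → v ∈ S ∖ subtree₂ S x
      rest⁺ v∈S ¬near = ∈-∖⁺ {S = S} {C = subtree₂ S x} v∈S (∌ ¬near)

      rest⁻ : ∀ {v} → v ∈ S ∖ subtree₂ S x → v ∈ S × ¬ Within₂ x v
      rest⁻ {v} v∈ = let v∈S , v∉ = ∈-∖⁻ {S = S} {C = subtree₂ S x} v∈ in
        v∈S , λ near → true≢false (trans (sym (∈⁺ v∈S near)) v∉)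

      rest-parent∈ : ∀ {v} → v ∈ S ∖ subtree₂ S x → v ≢ r → parent v ∈ S ∖ subtree₂ S x
      rest-parent∈ {v} v∈ v≢r = rest⁺ (parent∈ v∈S v≢r) ¬near-parent
        where
        v∈S : v ∈ S
        v∈S = proj₁ (rest⁻ v∈)
        ¬near : ¬ Within₂ x v
        ¬near = proj₂ (rest⁻ v∈)
        ¬near-parent : ¬ Within₂ x (parent v)
        ¬near-parent (inj₁ pv≡x)            = ¬near (inj₂ (inj₁ pv≡x))
        ¬near-parent (inj₂ (inj₁ ppv≡x))    = ¬near (inj₂ (inj₂ ppv≡x))
        ¬near-parent (inj₂ (inj₂ refl)) = 1+n≰n (subst (_≤ 2 + depth x) too-deep (shallow v∈S))
          where
          too-deep : depth v ≡ 3 + depth x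
          too-deep = trans (depth-parent v≢r) (cong suc (depth-grandchild (≢r-of-parent x≢r)))

      parent-outside : ¬ Within₂ x (parent x)
      parent-outside (inj₁ px≡x)          = depth-<⇒≢ (depth-parent-< x≢r) px≡x
      parent-outside (inj₂ (inj₁ ppx≡x))  =
        depth-<⇒≢ (≤-<-trans (depth-parent-≤ (parent x)) (depth-parent-< x≢r)) ppx≡x
      parent-outside (inj₂ (inj₂ pppx≡x)) = depth-<⇒≢
        (≤-<-trans (depth-parent-≤ (parent (parent x)))
          (≤-<-trans (depth-parent-≤ (parent x)) (depth-parent-< x≢r))) pppx≡x

  three-distinct : ∀ {R : VertexSet n} {x y z} → ∣ R ∣ ≤ 2 → x ∈ R → y ∈ R → z ∈ R →
                   x ≢ y → x ≢ z → y ≢ z → ⊥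
  three-distinct {R} small x∈ y∈ z∈ x≢y x≢z y≢z =
    ≤⇒≯ small (∣∣-≥3 {S = R} x∈ y∈ z∈ x≢y x≢z y≢z)

  module SmallClosed (R : VertexSet n) (closed : Closed R) (small : ∣ R ∣ ≤ 2) where
    open Closed closed

    parent-is-other : ∀ {w z} → w ∈ R → z ∈ R → w ≢ z → w ≢ r → parent w ≡ z
    parent-is-other {w} {z} w∈ z∈ w≢z w≢r with parent w ≟ z
    ... | yes pw≡z = pw≡z
    ... | no pw≢z  = ⊥-elim (three-distinct {R = R} small w∈ z∈ (parent∈ w∈ w≢r) w≢z
                              (depth-<⇒≢ (depth-parent-< w≢r) ∘ sym) (pw≢z ∘ sym))

    adjacent : ∀ {w z} → w ∈ R → z ∈ R → w ≢ z → adj G w z ≡ true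
    adjacent {w} {z} w∈ z∈ w≢z with w ≟ r
    ... | no w≢r   = subst (λ y → adj G w y ≡ true) (parent-is-other w∈ z∈ w≢z w≢r) (parent-adj w≢r)
    ... | yes refl = trans (adj-sym G r z)
                       (subst (λ y → adj G z y ≡ true) (parent-is-other z∈ w∈ (w≢z ∘ sym) (w≢z ∘ sym))
                              (parent-adj (w≢z ∘ sym)))

    unique : ∀ {z v v′} → z ∈ R → v ∈ R → v′ ∈ R → v ≢ z → v′ ≢ z → v ≡ v′
    unique {v = v} {v′} z∈ v∈ v′∈ v≢z v′≢z with v ≟ v′
    ... | yes v≡v′ = v≡v′
    ... | no v≢v′  = ⊥-elim (three-distinct {R = R} small z∈ v∈ v′∈ (v≢z ∘ sym) (v′≢z ∘ sym) v≢v′)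

  -- The at most two vertices left over form a path ending at the parent of the centre, which
  -- becomes one more leg.
  absorb : ∀ S {C} (sp : Spider G C) → C ⊆ S → Spider.centre sp ≢ r → Closed (S ∖ C) →
           parent (Spider.centre sp) ∈ S ∖ C → ∣ S ∖ C ∣ ≤ 2 → Spider G S
  absorb S {C} sp C⊆S c≢r rest-closed z∈R small = record
    { centre       = centre
    ; up           = up′
    ; centre∈      = C⊆S centre∈
    ; up∈          = up′∈
    ; up-adj       = up′-adj
    ; up-up        = up′-up′
    ; up-injective = up′-injective
    }
    where
    open Spider sp
    open SmallClosed (S ∖ C) rest-closed small
    z : Fin n
    z = parent centre
    z∈S : z ∈ S
    z∈S = proj₁ (∈-∖⁻ {S = S} {C = C} z∈R)
    z∉C : z ∉ C
    z∉C = proj₂ (∈-∖⁻ {S = S} {C = C} z∈R)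

    up′ : Fin n → Fin n
    up′ v with C v | v ≟ z
    ... | true  | _     = up v
    ... | false | yes _ = centre
    ... | false | no _  = z

    up′-cases : ∀ {v} → v ∈ S →
                (v ∈ C × up′ v ≡ up v) ⊎ (v ≡ z × up′ v ≡ centre) ⊎ (v ∈ S ∖ C × v ≢ z × up′ v ≡ z)
    up′-cases {v} v∈S with C v | v ≟ z
    ... | true  | _       = inj₁ (refl , refl)
    ... | false | yes v≡z = inj₂ (inj₁ (v≡z , refl))
    ... | false | no v≢z  = inj₂ (inj₂ (trans (Bool.∧-identityʳ (S v)) v∈S , v≢z , refl))

    up′-of-C : ∀ {v} → v ∈ C → up′ v ≡ up v
    up′-of-C {v} v∈C with C v | v ≟ z
    ... | true | _ = refl

    up′-z : up′ z ≡ centre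
    up′-z with C z | z ≟ z | z∉C
    ... | false | yes _   | _ = refl
    ... | false | no z≢z  | _ = ⊥-elim (z≢z refl)

    up′∈ : ∀ {v} → v ∈ S → v ≢ centre → up′ v ∈ S
    up′∈ v∈S v≢c with up′-cases v∈S
    ... | inj₁ (v∈C , eq)          = subst (_∈ S) (sym eq) (C⊆S (up∈ v∈C v≢c))
    ... | inj₂ (inj₁ (_ , eq))     = subst (_∈ S) (sym eq) (C⊆S centre∈)
    ... | inj₂ (inj₂ (_ , _ , eq)) = subst (_∈ S) (sym eq) z∈S

    up′-adj : ∀ {v} → v ∈ S → v ≢ centre → adj G v (up′ v) ≡ true
    up′-adj {v} v∈S v≢c with up′-cases v∈S
    ... | inj₁ (v∈C , eq)            = subst (λ w → adj G v w ≡ true) (sym eq) (up-adj v∈C v≢c)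
    ... | inj₂ (inj₁ (refl , eq))    =
      subst (λ w → adj G z w ≡ true) (sym eq) (trans (adj-sym G z centre) (parent-adj c≢r))
    ... | inj₂ (inj₂ (v∈R , v≢z , eq)) = subst (λ w → adj G v w ≡ true) (sym eq) (adjacent v∈R z∈R v≢z)

    up′-up′ : ∀ {v} → v ∈ S → v ≢ centre → up′ v ≢ centre → up′ (up′ v) ≡ centre
    up′-up′ {v} v∈S v≢c up′≢c with up′-cases v∈S
    ... | inj₁ (v∈C , eq)          =
      trans (cong up′ eq) (trans (up′-of-C (up∈ v∈C v≢c)) (up-up v∈C v≢c (up′≢c ∘ trans eq)))
    ... | inj₂ (inj₁ (_ , eq))     = ⊥-elim (up′≢c eq)
    ... | inj₂ (inj₂ (_ , _ , eq)) = trans (cong up′ eq) up′-z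

    up≢z : ∀ {v} → v ∈ C → v ≢ centre → up v ≢ z
    up≢z v∈C v≢c up≡z = true≢false (trans (sym (up∈ v∈C v≢c)) (subst (_∉ C) (sym up≡z) z∉C))

    up′-injective : ∀ {b b′} → b ∈ S → b′ ∈ S → b ≢ centre → b′ ≢ centre →
                    up′ b ≢ centre → up′ b ≡ up′ b′ → b ≡ b′
    up′-injective b∈S b′∈S b≢c b′≢c up′b≢c eq with up′-cases b∈S | up′-cases b′∈S
    ... | inj₁ (b∈C , eqb) | inj₁ (b′∈C , eqb′) =
      up-injective b∈C b′∈C b≢c b′≢c (up′b≢c ∘ trans eqb) (trans (sym eqb) (trans eq eqb′))
    ... | inj₂ (inj₁ (_ , eqb)) | _ = ⊥-elim (up′b≢c eqb)
    ... | _ | inj₂ (inj₁ (_ , eqb′)) = ⊥-elim (up′b≢c (trans eq eqb′))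
    ... | inj₁ (b∈C , eqb) | inj₂ (inj₂ (_ , _ , eqb′)) =
      ⊥-elim (up≢z b∈C b≢c (trans (sym eqb) (trans eq eqb′)))
    ... | inj₂ (inj₂ (_ , _ , eqb)) | inj₁ (b′∈C , eqb′) =
      ⊥-elim (up≢z b′∈C b′≢c (trans (sym eqb′) (trans (sym eq) eqb)))
    ... | inj₂ (inj₂ (b∈R , b≢z , _)) | inj₂ (inj₂ (b′∈R , b′≢z , _)) = unique z∈R b∈R b′∈R b≢z b′≢z

  record Cut (S : VertexSet n) : Set where
    field
      piece          : VertexSet n
      spider         : Spider G piece
      piece⊆         : piece ⊆ S
      large          : 3 ≤ ∣ piece ∣
      centre≢r       : Spider.centre spider ≢ r
      rest-closed    : Closed (S ∖ piece)
      parent-centre∈ : parent (Spider.centre spider) ∈ S ∖ piece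

  subtree₂-cut : ∀ {S x} → Closed S → x ∈ S → x ≢ r → (∀ {v} → v ∈ S → depth v ≤ 2 + depth x) →
                 NoGrandTwins S x → 3 ≤ ∣ subtree₂ S x ∣ → Cut S
  subtree₂-cut {S} {x} closed x∈S x≢r shallow no-twins large = record
    { piece          = subtree₂ S x
    ; spider         = Subtree₂.spider S x closed x∈S x≢r no-twins
    ; piece⊆         = λ v∈ → proj₁ (Subtree₂.∈⁻ S x v∈)
    ; large          = large
    ; centre≢r       = x≢r
    ; rest-closed    = proj₁ (Subtree₂.rest S x closed x∈S x≢r shallow)
    ; parent-centre∈ = proj₂ (Subtree₂.rest S x closed x∈S x≢r shallow)
    }

  deepest : ∀ {S} → Closed S → ∃ λ u → u ∈ S × (∀ {v} → v ∈ S → depth v ≤ depth u)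
  deepest {S} closed =
    u , u∈S , λ {v} v∈S → ≤-pred (subst₂ _≤_ (cong (height v) v∈S) (cong (height u) u∈S) (height≤ v))
    where
    open Closed closed
    height : Fin n → Bool → ℕ
    height v b = if b then suc (depth v) else 0
    u : Fin n
    u = argmax (λ v → height v (S v)) r (allFin n)
    height≤ : ∀ v → height v (S v) ≤ height u (S u)
    height≤ v = All.lookup (f[xs]≤f[argmax] r (allFin n)) (∈-allFin v)
    u∈S : u ∈ S
    u∈S with S u | height≤ r
    ... | true  | _    = refl
    ... | false | hr≤0 with subst (λ b → height r b ≤ 0) root∈ hr≤0
    ...   | ()

  Twins : VertexSet n → ℕ → Fin n → Fin n → Set
  Twins S D b b′ = b ∈ S × b′ ∈ S × b ≢ b′ × parent b ≡ parent b′ × parent b ≢ r × depth b ≡ D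

  twins? : ∀ S D → Dec (∃₂ (Twins S D))
  twins? S D = any? λ b → any? λ b′ →
    (S b Bool.≟ true) ×-dec (S b′ Bool.≟ true) ×-dec ¬? (b ≟ b′) ×-dec (parent b ≟ parent b′) ×-dec
    ¬? (parent b ≟ r) ×-dec (depth b ℕ.≟ D)

  ≢r-of-depth : ∀ {v} → 1 ≤ depth v → v ≢ r
  ≢r-of-depth 1≤d refl = 1+n≰n (≤-trans 1≤d (≤-reflexive depth-root))

  module _ {S : VertexSet n} (closed : Closed S) {u : Fin n} (u∈S : u ∈ S)
           (maximal : ∀ {v} → v ∈ S → depth v ≤ depth u) where
    open Closed closed

    star-cut : ∃₂ (Twins S (depth u)) → Cut S
    star-cut (b₁ , b₂ , b₁∈S , b₂∈S , b₁≢b₂ , pb₁≡pb₂ , x≢r , deepest₁) =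
      subtree₂-cut closed x∈S x≢r shallow no-grandchildren
        (∣∣-≥3 {S = subtree₂ S x}
          (∈⁺ x∈S (inj₁ refl)) (∈⁺ b₁∈S (inj₂ (inj₁ refl))) (∈⁺ b₂∈S (inj₂ (inj₁ (sym pb₁≡pb₂))))
          (depth-<⇒≢ (depth-parent-< b₁≢r))
          (depth-<⇒≢ (subst (λ w → depth w < depth b₂) (sym pb₁≡pb₂) (depth-parent-< b₂≢r)))
          b₁≢b₂)
      where
      x : Fin n
      x = parent b₁
      open Subtree₂ S x using (∈⁺)
      b₁≢r : b₁ ≢ r
      b₁≢r = ≢r-of-parent x≢r
      b₂≢r : b₂ ≢ r
      b₂≢r = ≢r-of-parent (subst (_≢ r) pb₁≡pb₂ x≢r)
      x∈S : x ∈ S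
      x∈S = parent∈ b₁∈S b₁≢r
      depth-b₁ : depth u ≡ suc (depth x)
      depth-b₁ = trans (sym deepest₁) (depth-parent b₁≢r)
      shallow : ∀ {v} → v ∈ S → depth v ≤ 2 + depth x
      shallow v∈S = ≤-trans (maximal v∈S) (≤-trans (≤-reflexive depth-b₁) (n≤1+n _))
      no-grandchildren : NoGrandTwins S x
      no-grandchildren {b} b∈S _ _ _ ppb≡x = 1+n≰n (begin
        suc (depth u)                ≡⟨ cong suc depth-b₁ ⟩
        2 + depth x                  ≡⟨ cong (λ w → 2 + depth w) ppb≡x ⟨
        2 + depth (parent (parent b)) ≡⟨ depth-grandchild (≢r-of-parent (subst (_≢ r) (sym ppb≡x) x≢r)) ⟨
        depth b                      ≤⟨ maximal b∈S ⟩
        depth u                      ∎)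
        where open ≤-Reasoning

    deep-cut : ¬ ∃₂ (Twins S (depth u)) → 3 ≤ depth u → Cut S
    deep-cut no-twins 3≤du = subtree₂-cut closed g∈S g≢r shallow no-grandtwins
      (∣∣-≥3 {S = subtree₂ S g}
             (∈⁺ g∈S (inj₁ refl)) (∈⁺ pu∈S (inj₂ (inj₁ refl))) (∈⁺ u∈S (inj₂ (inj₂ refl)))
             (depth-<⇒≢ (depth-parent-< pu≢r)) (depth-<⇒≢ (subst (depth g <_) (sym depth-u) (s≤s (n≤1+n _))))
             (depth-<⇒≢ (depth-parent-< u≢r)))
      where
      u≢r : u ≢ r
      u≢r = ≢r-of-depth (≤-trans (s≤s z≤n) 3≤du)
      pu≢r : parent u ≢ r
      pu≢r = ≢r-of-depth (≤-trans (s≤s z≤n) (≤-pred (subst (3 ≤_) (depth-parent u≢r) 3≤du)))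
      g : Fin n
      g = parent (parent u)
      open Subtree₂ S g using (∈⁺)
      depth-u : depth u ≡ 2 + depth g
      depth-u = depth-grandchild pu≢r
      g≢r : g ≢ r
      g≢r = ≢r-of-depth (≤-pred (≤-pred (subst (3 ≤_) depth-u 3≤du)))
      pu∈S : parent u ∈ S
      pu∈S = parent∈ u∈S u≢r
      g∈S : g ∈ S
      g∈S = parent∈ pu∈S pu≢r
      shallow : ∀ {v} → v ∈ S → depth v ≤ 2 + depth g
      shallow {v} v∈S = subst (depth v ≤_) depth-u (maximal v∈S)
      no-grandtwins : NoGrandTwins S g
      no-grandtwins {b} {b′} b∈S b′∈S b≢b′ pb≡pb′ ppb≡g =
        no-twins (b , b′ , b∈S , b′∈S , b≢b′ , pb≡pb′ , pb≢r ,
                  trans (depth-grandchild pb≢r) (trans (cong (λ w → 2 + depth w) ppb≡g) (sym depth-u)))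
        where
        pb≢r : parent b ≢ r
        pb≢r = ≢r-of-parent (subst (_≢ r) (sym ppb≡g) g≢r)

    root-spider : ¬ ∃₂ (Twins S (depth u)) → depth u ≤ 2 → Spider G S
    root-spider no-twins du≤2 = record
      { centre       = r
      ; up           = parent
      ; centre∈      = root∈
      ; up∈          = parent∈
      ; up-adj       = λ _ → parent-adj
      ; up-up        = up-up
      ; up-injective = up-injective
      }
      where
      up-up : ∀ {v} → v ∈ S → v ≢ r → parent v ≢ r → parent (parent v) ≡ r
      up-up v∈S _ pv≢r =
        depth≡0 (n≤0⇒n≡0 (≤-pred (≤-pred
          (subst (_≤ 2) (depth-grandchild pv≢r) (≤-trans (maximal v∈S) du≤2)))))

      up-injective : ∀ {b b′} → b ∈ S → b′ ∈ S → b ≢ r → b′ ≢ r →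
                     parent b ≢ r → parent b ≡ parent b′ → b ≡ b′
      up-injective {b} {b′} b∈S b′∈S _ _ pb≢r pb≡pb′ with b ≟ b′
      ... | yes b≡b′ = b≡b′
      ... | no b≢b′  = ⊥-elim (no-twins (b , b′ , b∈S , b′∈S , b≢b′ , pb≡pb′ , pb≢r , depth-b))
        where
        depth-b : depth b ≡ depth u
        depth-b = ≤-antisym (maximal b∈S)
                            (≤-trans du≤2 (subst (2 ≤_) (sym (depth-grandchild pb≢r)) (m≤m+n 2 _)))

  -- With u a deepest vertex of S: two deepest siblings with a parent x ≠ r give a star at x.
  -- Otherwise no two deepest vertices below r are siblings, so the grandparent of u with the two
  -- levels below it is a spider, or S itself is a spider centred at r if u has depth at most two.
  spider-or-cut : ∀ {S} → Closed S → Spider G S ⊎ Cut S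
  spider-or-cut {S} closed with deepest closed
  ... | u , u∈S , maximal with twins? S (depth u)
  ... | yes twins  = inj₂ (star-cut closed u∈S maximal twins)
  ... | no ¬twins with depth u ≤? 2
  ...   | yes du≤2 = inj₁ (root-spider closed u∈S maximal ¬twins du≤2)
  ...   | no du≰2  = inj₂ (deep-cut closed u∈S maximal ¬twins (≰⇒> du≰2))

  module _ (P : VertexSet n → Set)
           (P-∪ : ∀ {S C} → C ⊆ S → P C → P (S ∖ C) → P S)
           (P-spider : ∀ {C} → Spider G C → 3 ≤ ∣ C ∣ → P C) where

    cut-off : ∀ {S} → Cut S → 3 ≤ ∣ S ∣ →
              (∀ {S′} → ∣ S′ ∣ < ∣ S ∣ → Closed S′ → 3 ≤ ∣ S′ ∣ → P S′) → P S
    cut-off {S} cut 3≤∣S∣ IH = decide (3 ≤? ∣ S ∖ piece ∣)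
      where
      open Cut cut
      decide : Dec (3 ≤ ∣ S ∖ piece ∣) → P S
      decide (yes 3≤rest) = P-∪ piece⊆ (P-spider spider large) (IH rest<S rest-closed 3≤rest)
        where
        rest<S : ∣ S ∖ piece ∣ < ∣ S ∣
        rest<S = subst (∣ S ∖ piece ∣ <_) (sym (∣∣-split {S = S} {C = piece} piece⊆))
                       (m<n+m ∣ S ∖ piece ∣ (≤-trans (s≤s z≤n) large))
      decide (no ¬3≤rest) =
        P-spider (absorb S spider piece⊆ centre≢r rest-closed parent-centre∈ (≤-pred (≰⇒> ¬3≤rest)))
                 3≤∣S∣

    closed-induction : ∀ {S} → Closed S → 3 ≤ ∣ S ∣ → P S
    closed-induction {S} = <-rec Goal induction-step ∣ S ∣ refl
      where
      Goal : ℕ → Set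
      Goal m = ∀ {S} → ∣ S ∣ ≡ m → Closed S → 3 ≤ ∣ S ∣ → P S
      induction-step : ∀ m → (∀ {m′} → m′ < m → Goal m′) → Goal m
      induction-step _ IH refl closed 3≤∣S∣ with spider-or-cut closed
      ... | inj₁ spider = P-spider spider 3≤∣S∣
      ... | inj₂ cut    = cut-off cut 3≤∣S∣ (λ smaller → IH smaller refl)

module _ {n} {G : Graph n} {k a d : ℕ} where
  open Labelling G k

  cheap⇒γ≤ : CheapLabelling roman a d full → γ≤ k G (a * n) d
  cheap⇒γ≤ L =
    label , (bounded , λ _ → dominating refl) , subst (λ m → d * weight label ≤ a * m) ∣full∣ cheap
    where open CheapLabelling roman L

  cheap⇒γˢ≤ : CheapLabelling strong a d full → γˢ≤ k G (a * n) d
  cheap⇒γˢ≤ L =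
    label , (bounded , λ _ → dominating refl) , subst (λ m → d * weight label ≤ a * m) ∣full∣ cheap
    where open CheapLabelling strong L

connected⇒cheap : ∀ {n} (G : Graph n) → Connected G → 3 ≤ n → ∀ {k mode a d} →
                   (∀ p q → 3 ≤ 1 + p + q + q → Affordable k mode a d p q) →
                   Labelling.CheapLabelling G k mode a d full
connected⇒cheap {suc n} G conn 3≤n {k} {mode} {a} {d} affordable =
  closed-induction (CheapLabelling a d) cheap-∪ spider-cheap full-closed (subst (3 ≤_) (sym ∣full∣) 3≤n)
  where
  open SpiderDecomposition G zero conn
  open Labelling G k mode
  full-closed : Closed full
  full-closed = record { root∈ = refl ; parent∈ = λ _ _ → refl }
  spider-cheap : ∀ {C} → Spider G C → 3 ≤ ∣ C ∣ → CheapLabelling a d C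
  spider-cheap sp 3≤∣C∣ = SpiderLabelling.affordable⇒cheap G k mode sp
    (affordable _ _ (subst (3 ≤_) (Anatomy.∣C∣≡legs sp) 3≤∣C∣))

corollary3p2 : (k n : ℕ) → 2 ≤ k → 3 ≤ n → (G : Graph n) → Connected G →
    ((m : ℕ) → k ≡ 2 * m + 1 → γ≤ k G ((3 * k + 1) * n) 8 × γˢ≤ k G ((3 * k + 1) * n) 8)
    × ((m : ℕ) → k ≡ 2 * m → γ≤ k G (3 * k * n) 8)
    × ((m : ℕ) → k ≡ 2 * m → k ≤ 6 → γˢ≤ k G (2 * k * n) 5)
    × ((m : ℕ) → k ≡ 2 * m → 8 ≤ k → γˢ≤ k G (3 * k * n) 8)
corollary3p2 k n 2≤k 3≤n G conn = odd , roman-even , strong-even , strong-even-large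
  where
  cheap : ∀ {mode a d} → (∀ p q → 3 ≤ 1 + p + q + q → Affordable k mode a d p q) →
          Labelling.CheapLabelling G k mode a d full
  cheap = connected⇒cheap G conn 3≤n

  odd : (m : ℕ) → k ≡ 2 * m + 1 → γ≤ k G ((3 * k + 1) * n) 8 × γˢ≤ k G ((3 * k + 1) * n) 8
  odd zero    refl = ⊥-elim (1+n≰n (≤-pred 2≤k))
  odd (suc m) refl = cheap⇒γ≤ (strong⇒roman labelling) , cheap⇒γˢ≤ labelling
    where
    labelling : Labelling.CheapLabelling G k strong (3 * k + 1) 8 full
    labelling = cheap (strong-odd-affordable m)

  roman-even : (m : ℕ) → k ≡ 2 * m → γ≤ k G (3 * k * n) 8
  roman-even m refl = cheap⇒γ≤ (cheap (roman-even-affordable m (*-cancelˡ-≤ 2 2≤k)))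

  -- The bound 2k/5 holds for every even k ≥ 2.
  strong-even : (m : ℕ) → k ≡ 2 * m → k ≤ 6 → γˢ≤ k G (2 * k * n) 5
  strong-even m refl _ = cheap⇒γˢ≤ (cheap (strong-even-affordable m (*-cancelˡ-≤ 2 2≤k)))

  strong-even-large : (m : ℕ) → k ≡ 2 * m → 8 ≤ k → γˢ≤ k G (3 * k * n) 8
  strong-even-large m refl 8≤k with m≤n⇒∃[o]m+o≡n (*-cancelˡ-≤ {4} {m} 2 8≤k)
  ... | m′ , refl = cheap⇒γˢ≤ (cheap (strong-even≥8-affordable m′))
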